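{- Let $f\in F_n^{\nearrow}$. Then $f\in Y_n$ (i.e. $f_i=i$ for every $i\in\mathrm{Im}(f)$) if and only if $\phi(f)\in\mathfrak{S}_n^{\nearrow}(312)$, i.e. $\phi(f)$ avoids the pattern $312$.
   Context: $[n]=\{1,\dots,n\}$, $\mathfrak{S}_n$ the symmetric group on $[n]$; products of permutations are composed with the leftmost factor acting first: $(\alpha\beta)(x)=\beta(\alpha(x))$. A function $f:[n]\to[n]$ is subexceedant if $1\le f(i)\le i$ for all $i$, written $f_1\cdots f_n$; $F_n$ is the set of such functions and $\mathrm{Im}(f)=f([n])$. $\phi:F_n\to\mathfrak{S}_n$, $\phi(f)=(1,f_1)(2,f_2)\cdots(n,f_n)$ (with $(i,i)$ the identity), is a bijection. $F_n^{\nearrow}$ is the set of non-decreasing subexceedant functions on $[n]$, $\mathfrak{S}_n^{\nearrow}=\phi(F_n^{\nearrow})$. $Y_n=\{f\in F_n^{\nearrow}: f_i=i \text{ for all } i\in\mathrm{Im}(f)\}$. A permutation $\sigma$ avoids $312$ if there are no $a<b<c$ with $\sigma(b)<\sigma(c)<\sigma(a)$. -}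

module Defs where

open import Data.Nat using (ℕ; _≤_; _<_)
open import Data.Fin using (Fin; toℕ; _≟_)
open import Data.List using (List; foldl)
open import Data.List using () renaming ([] to []ᴸ)
open import Data.Fin.Base using () renaming (_<_ to _<ᶠ_)
open import Data.Product using (Σ; _×_; ∃-syntax)
open import Relation.Nullary using (¬_; does)
open import Data.Bool using (if_then_else_)
open import Data.List using (allFin)
open import Relation.Binary.PropositionalEquality using (_≡_)

-- Elements of [n] are represented by Fin n (value i represents i+1).

Subexceedant : {n : ℕ} → (Fin n → Fin n) → Set
Subexceedant f = ∀ i → toℕ (f i) ≤ toℕ i

NonDecreasing : {n : ℕ} → (Fin n → Fin n) → Set
NonDecreasing f = ∀ i j → toℕ i ≤ toℕ j → toℕ (f i) ≤ toℕ (f j)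

InFnInc : {n : ℕ} → (Fin n → Fin n) → Set
InFnInc f = Subexceedant f × NonDecreasing f

InIm : {n : ℕ} → (Fin n → Fin n) → Fin n → Set
InIm f j = ∃[ i ] f i ≡ j

InY : {n : ℕ} → (Fin n → Fin n) → Set
InY f = InFnInc f × (∀ i → InIm f i → f i ≡ i)

transp : {n : ℕ} → Fin n → Fin n → Fin n → Fin n
transp a b x =
  if does (x ≟ a) then b else (if does (x ≟ b) then a else x)

-- φ(f) = (1,f_1)(2,f_2)⋯(n,f_n), composed with the leftmost factor acting
-- first: φ(f)(x) = (n,f_n)( ⋯ (1,f_1)(x) ⋯ ).
phi : {n : ℕ} → (Fin n → Fin n) → Fin n → Fin n
phi {n} f x = foldl (λ y i → transp i (f i) y) x (allFin n)

Avoids312 : {n : ℕ} → (Fin n → Fin n) → Set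
Avoids312 {n} σ =
  ¬ (Σ (Fin n) λ a → Σ (Fin n) λ b → Σ (Fin n) λ c →
       (a <ᶠ b) × (b <ᶠ c) × (σ b <ᶠ σ c) × (σ c <ᶠ σ a))

{-# OPTIONS --safe #-}
-- φ(f)(x) is computed by pushing x through the factors (i, f i) in order: the factors with
-- i < x leave it alone, the factor at x sends it to f x, and from then on a value y < i
-- moves exactly when f i = y, to i.  If f fixes its image, this forces φ(f)(x) to be
-- x + 1 or f x, and a 312 occurrence a < b < c would give f c ≤ a < b, hence
-- f c = f (f c) ≤ f b < f c.  Conversely, take the least v in the image with u = f v < v
-- (so f u = u): then v - 1, the last index b with f b < v and the last preimage c of v
-- form a 312 occurrence, with φ(f)(b) = f b < v = φ(f)(c) < φ(f)(v - 1).
module Submission where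

open import Defs
open import Data.Nat using (ℕ; zero; suc; _+_; _∸_; _≤_; _<_; _<?_; z≤n; s≤s; s≤s⁻¹)
open import Data.Nat.Properties
  using (≤-refl; ≤-trans; ≤-antisym; ≤-reflexive; <⇒≤; <-trans; <-≤-trans; ≤-<-trans; <⇒≢; ≤⇒≯; ≰⇒>;
         <-asym; m<n⇒m<1+n; m≤n⇒m≤1+n; ∸-monoʳ-<; +-identityʳ; +-suc)
open import Data.Fin using (Fin; toℕ; _≟_; inject₁)
open import Data.Fin.Properties
  using (toℕ-injective; toℕ<n; toℕ-inject₁; any?)
  renaming (<⇒≢ to <⇒≢ᶠ; ≤∧≢⇒< to ≤∧≢⇒<ᶠ)
open import Data.Fin.Induction using (<-wellFounded)
open import Data.List using (List; []; _∷_; foldl; allFin; tabulate)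
open import Data.Product using (Σ; _×_; _,_; ∃-syntax)
open import Data.Sum using (_⊎_; inj₁; inj₂)
open import Function using (_∘_; id)
open import Induction.WellFounded using (module All)
open import Level using (0ℓ)
open import Relation.Nullary using (¬_; Dec; yes; no; contradiction)
open import Relation.Nullary.Decidable using (_×-dec_)
open import Relation.Unary using (Decidable)
open import Relation.Binary.PropositionalEquality
  using (_≡_; _≢_; refl; sym; trans; cong; subst; subst₂)

predecessor : ∀ {n} (v : Fin n) → 0 < toℕ v → Σ (Fin n) λ a → suc (toℕ a) ≡ toℕ v
predecessor (Fin.suc w) _ = inject₁ w , cong suc (toℕ-inject₁ w)

module _ {N : ℕ} where

  transp-source : (a b : Fin N) → transp a b a ≡ b
  transp-source a b with a ≟ a
  ... | yes _   = refl
  ... | no a≢a = contradiction refl a≢a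

  transp-target : (a b : Fin N) → b ≢ a → transp a b b ≡ a
  transp-target a b b≢a with b ≟ a
  ... | yes b≡a = contradiction b≡a b≢a
  ... | no _ with b ≟ b
  ...   | yes _   = refl
  ...   | no b≢b = contradiction refl b≢b

  transp-fixes : (a b y : Fin N) → y ≢ a → y ≢ b → transp a b y ≡ y
  transp-fixes a b y y≢a y≢b with y ≟ a
  ... | yes y≡a = contradiction y≡a y≢a
  ... | no _ with y ≟ b
  ...   | yes y≡b = contradiction y≡b y≢b
  ...   | no _    = refl

  IsGreatest : (Fin N → Set) → Fin N → Set
  IsGreatest P m = P m × (∀ j → toℕ m < toℕ j → ¬ P j)

  greatest-above : {P : Fin N → Set} → Decidable P → ∀ {x} → P x →
                   ∃[ m ] toℕ x ≤ toℕ m × IsGreatest P m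
  greatest-above {P} P? {x} px = search (suc (N ∸ toℕ x)) ≤-refl px
    where
    search : ∀ d {x} → N ∸ toℕ x < d → P x → ∃[ m ] toℕ x ≤ toℕ m × IsGreatest P m
    search (suc d) {x} gap px with any? (λ j → (toℕ x <? toℕ j) ×-dec P? j)
    ... | no none = x , ≤-refl , px , λ j x<j pj → none (j , x<j , pj)
    ... | yes (j , x<j , pj) =
      let m , j≤m , greatest = search d (<-≤-trans (∸-monoʳ-< x<j (<⇒≤ (toℕ<n j))) (s≤s⁻¹ gap)) pj
      in  m , ≤-trans (<⇒≤ x<j) j≤m , greatest

  nonDecreasing-squeeze : {f : Fin N → Fin N} → NonDecreasing f → ∀ {x i j} →
                          toℕ x ≤ toℕ i → toℕ i ≤ toℕ j → f x ≡ f j → f i ≡ f x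
  nonDecreasing-squeeze mon x≤i i≤j fx≡fj = toℕ-injective (≤-antisym
    (≤-trans (mon _ _ i≤j) (≤-reflexive (cong toℕ (sym fx≡fj))))
    (mon _ _ x≤i))

module Sweep {N : ℕ} (f : Fin N → Fin N) where

  step : Fin N → Fin N → Fin N
  step y i = transp i (f i) y

  run : List (Fin N) → Fin N → Fin N
  run L y = foldl step y L

  data IndicesFrom : ℕ → List (Fin N) → Set where
    end  : ∀ {k} → k ≡ N → IndicesFrom k []
    next : ∀ {k i L} → toℕ i ≡ k → IndicesFrom (suc k) L → IndicesFrom k (i ∷ L)

  tabulate-indicesFrom : ∀ m k (h : Fin m → Fin N) → (∀ i → toℕ (h i) ≡ k + toℕ i) →
                         k + m ≡ N → IndicesFrom k (tabulate h)
  tabulate-indicesFrom zero    k h _     k+0≡N = end (trans (sym (+-identityʳ k)) k+0≡N)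
  tabulate-indicesFrom (suc m) k h toℕ-h k+m≡N =
    next (trans (toℕ-h Fin.zero) (+-identityʳ k))
         (tabulate-indicesFrom m (suc k) (h ∘ Fin.suc)
           (λ i → trans (toℕ-h (Fin.suc i)) (+-suc k (toℕ i)))
           (trans (sym (+-suc k m)) k+m≡N))

  allFin-indicesFrom : IndicesFrom 0 (allFin N)
  allFin-indicesFrom = tabulate-indicesFrom N 0 id (λ _ → refl) refl

  step-moves : ∀ {y i} → toℕ y < toℕ i → f i ≡ y → step y i ≡ i
  step-moves {i = i} fi<i refl = transp-target i (f i) (<⇒≢ᶠ fi<i)

  step-fixes : ∀ {y i} → y ≢ i → f i ≢ y → step y i ≡ y
  step-fixes {y} {i} y≢i fi≢y = transp-fixes i (f i) y y≢i (fi≢y ∘ sym)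

  run-fixes : ∀ {k L y} → IndicesFrom k L → toℕ y < k → (∀ j → k ≤ toℕ j → f j ≢ y) →
              run L y ≡ y
  run-fixes (end _) _ _ = refl
  run-fixes {L = i ∷ L} (next refl is) y<i unhit =
    trans (cong (run L) (step-fixes (<⇒≢ᶠ y<i) (unhit i ≤-refl)))
          (run-fixes is (m<n⇒m<1+n y<i) (λ j i<j → unhit j (<⇒≤ i<j)))

  run-≥ : ∀ {k L y} → IndicesFrom k L → toℕ y < k → toℕ y ≤ toℕ (run L y)
  run-≥ (end _) _ = ≤-refl
  run-≥ {L = i ∷ L} {y} (next refl is) y<i with f i ≟ y
  ... | yes fi≡y rewrite step-moves y<i fi≡y = ≤-trans (<⇒≤ y<i) (run-≥ is ≤-refl)
  ... | no fi≢y rewrite step-fixes (<⇒≢ᶠ y<i) fi≢y = run-≥ is (m<n⇒m<1+n y<i)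

  run-> : ∀ {k L y j} → IndicesFrom k L → toℕ y < k → k ≤ toℕ j → f j ≡ y →
          toℕ y < toℕ (run L y)
  run-> {j = j} (end refl) _ N≤j _ = contradiction (toℕ<n j) (≤⇒≯ N≤j)
  run-> {L = i ∷ L} {y} {j} (next refl is) y<i i≤j fj≡y with f i ≟ y
  ... | yes fi≡y rewrite step-moves y<i fi≡y = <-≤-trans y<i (run-≥ is ≤-refl)
  ... | no fi≢y rewrite step-fixes (<⇒≢ᶠ y<i) fi≢y =
    run-> is (m<n⇒m<1+n y<i) (≤∧≢⇒<ᶠ i≤j (λ i≡j → fi≢y (trans (cong f i≡j) fj≡y))) fj≡y

  module _ (sub : Subexceedant f) where

    -- Every factor (i, f i) with i < x leaves x alone, since f i ≤ i < x.
    run-reaches : ∀ {k L} x → IndicesFrom k L → k ≤ toℕ x →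
                  ∃[ L′ ] IndicesFrom (suc (toℕ x)) L′ × run L x ≡ run L′ (f x)
    run-reaches x (end refl) N≤x = contradiction (toℕ<n x) (≤⇒≯ N≤x)
    run-reaches x (next {i = i} {L} refl is) i≤x with i ≟ x
    ... | yes refl = L , is , cong (run L) (transp-source i (f i))
    ... | no i≢x =
      let L′ , is′ , eq = run-reaches x is i<x
      in  L′ , is′ , trans (cong (run L) (step-fixes (i≢x ∘ sym) (<⇒≢ᶠ (≤-<-trans (sub i) i<x)))) eq
      where
      i<x : toℕ i < toℕ x
      i<x = ≤∧≢⇒<ᶠ i≤x i≢x

    phi-from-image : ∀ x → ∃[ L ] IndicesFrom (suc (toℕ x)) L × phi f x ≡ run L (f x)
    phi-from-image x = run-reaches x allFin-indicesFrom z≤n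

    phi-fixed-value : ∀ x → (∀ j → toℕ x < toℕ j → f j ≢ f x) → phi f x ≡ f x
    phi-fixed-value x unhit =
      let L , is , eq = phi-from-image x in trans eq (run-fixes is (s≤s (sub x)) unhit)

    module _ (mon : NonDecreasing f) where

      module _ (fixes-image : ∀ i → InIm f i → f i ≡ i) where

        phi-in-Y : ∀ x → toℕ (phi f x) ≡ suc (toℕ x) ⊎ phi f x ≡ f x
        phi-in-Y x with phi-from-image x
        ... | [] , _ , eq = inj₂ eq
        ... | i ∷ L , next i≡1+x is , eq = first-step (f i ≟ f x)
          where
          x<i : toℕ x < toℕ i
          x<i = ≤-reflexive (sym i≡1+x)

          fx<i : toℕ (f x) < toℕ i
          fx<i = ≤-<-trans (sub x) x<i

          i<2+x : toℕ i < suc (suc (toℕ x))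
          i<2+x = s≤s (≤-reflexive i≡1+x)

          first-step : Dec (f i ≡ f x) → toℕ (phi f x) ≡ suc (toℕ x) ⊎ phi f x ≡ f x
          first-step (yes fi≡fx) =
            inj₁ (trans (cong toℕ (trans eq (trans (cong (run L) (step-moves fx<i fi≡fx))
                                                   (run-fixes is i<2+x i-unhit))))
                        i≡1+x)
            where
            i-unhit : ∀ j → suc (suc (toℕ x)) ≤ toℕ j → f j ≢ i
            i-unhit j _ fj≡i =
              <⇒≢ᶠ (subst (λ z → toℕ z < toℕ i) (sym fi≡fx) fx<i) (fixes-image i (j , fj≡i))
          first-step (no fi≢fx) =
            inj₂ (trans eq (trans (cong (run L) (step-fixes (<⇒≢ᶠ fx<i) fi≢fx))
                                  (run-fixes is (<-trans fx<i i<2+x) fx-unhit)))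
            where
            fx-unhit : ∀ j → suc (suc (toℕ x)) ≤ toℕ j → f j ≢ f x
            fx-unhit j 2+x≤j fj≡fx = fi≢fx (nonDecreasing-squeeze mon
              (<⇒≤ x<i) (<⇒≤ (<-≤-trans i<2+x 2+x≤j)) (sym fj≡fx))

        phi-≤-suc : ∀ x → toℕ (phi f x) ≤ suc (toℕ x)
        phi-≤-suc x with phi-in-Y x
        ... | inj₁ σx≡1+x = ≤-reflexive σx≡1+x
        ... | inj₂ σx≡fx  = ≤-trans (≤-reflexive (cong toℕ σx≡fx)) (m≤n⇒m≤1+n (sub x))

        below-phi-≤ : ∀ {x y : Fin N} → toℕ y < toℕ (phi f x) → toℕ y ≤ toℕ x
        below-phi-≤ {x} y<σx = s≤s⁻¹ (<-≤-trans y<σx (phi-≤-suc x))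

        Y⇒avoids312 : Avoids312 (phi f)
        Y⇒avoids312 (a , b , c , a<b , b<c , σb<σc , σc<σa) with phi-in-Y c | phi-in-Y b
        ... | inj₁ σc≡1+c | _ =
          <-asym (<-trans a<b b<c) (subst (_≤ toℕ a) σc≡1+c (below-phi-≤ σc<σa))
        ... | inj₂ _ | inj₁ σb≡1+b =
          <-asym a<b (subst (_≤ toℕ a) σb≡1+b (below-phi-≤ (<-trans σb<σc σc<σa)))
        ... | inj₂ σc≡fc | inj₂ σb≡fb = ≤⇒≯ fc≤fb fb<fc
          where
          fb<fc : toℕ (f b) < toℕ (f c)
          fb<fc = subst₂ (λ y z → toℕ y < toℕ z) σb≡fb σc≡fc σb<σc

          fc≤a : toℕ (f c) ≤ toℕ a
          fc≤a = below-phi-≤ (subst (λ z → toℕ z < toℕ (phi f a)) σc≡fc σc<σa)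

          fc≤fb : toℕ (f c) ≤ toℕ (f b)
          fc≤fb = subst (λ z → toℕ z ≤ toℕ (f b)) (fixes-image (f c) (c , refl))
                        (mon (f c) b (≤-trans fc≤a (<⇒≤ a<b)))

      -- a = v - 1 carries f v to v in the step at v; a later preimage x₀ of v then moves it further.
      phi-beyond-predecessor : ∀ {v x₀} → toℕ (f v) < toℕ v → f (f v) ≡ f v →
                               f x₀ ≡ v → toℕ v < toℕ x₀ →
                               Σ (Fin N) λ a → suc (toℕ a) ≡ toℕ v × toℕ v < toℕ (phi f a)
      phi-beyond-predecessor {v} {x₀} fv<v ffv≡fv fx₀≡v v<x₀ with predecessor v (≤-<-trans z≤n fv<v)
      ... | a , 1+a≡v with phi-from-image a
      ...   | [] , end 1+a≡N , _ = contradiction (trans (sym 1+a≡v) 1+a≡N) (<⇒≢ (toℕ<n v))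
      ...   | i ∷ L , next i≡1+a is , σa≡ with toℕ-injective {i = i} {j = v} (trans i≡1+a 1+a≡v)
      ...     | refl = a , 1+a≡v , subst (λ z → toℕ v < toℕ z) (sym σa≡v) v<run
        where
        a<v : toℕ a < toℕ v
        a<v = ≤-reflexive 1+a≡v

        fv≤a : toℕ (f v) ≤ toℕ a
        fv≤a = s≤s⁻¹ (subst (toℕ (f v) <_) (sym 1+a≡v) fv<v)

        fa≡fv : f a ≡ f v
        fa≡fv = trans (nonDecreasing-squeeze mon fv≤a (<⇒≤ a<v) ffv≡fv) ffv≡fv

        σa≡v : phi f a ≡ run L v
        σa≡v = trans σa≡ (cong (run L) (step-moves (≤-<-trans (sub a) a<v) (sym fa≡fv)))

        v<run : toℕ v < toℕ (run L v)
        v<run = run-> is (s≤s (≤-reflexive i≡1+a)) (subst (λ z → suc z ≤ toℕ x₀) i≡1+a v<x₀) fx₀≡v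

      -- The occurrence is a = v - 1, b the last index with f b < v, c the last preimage of v.
      unfixed-image⇒¬avoids312 : ∀ {v x₀} → toℕ (f v) < toℕ v → f (f v) ≡ f v →
                                 f x₀ ≡ v → toℕ v < toℕ x₀ → ¬ Avoids312 (phi f)
      unfixed-image⇒¬avoids312 {v} {x₀} fv<v ffv≡fv fx₀≡v v<x₀ avoids
        with phi-beyond-predecessor fv<v ffv≡fv fx₀≡v v<x₀
           | greatest-above (λ j → toℕ (f j) <? toℕ v) fv<v
           | greatest-above (λ j → f j ≟ v) fx₀≡v
      ... | a , 1+a≡v , v<σa | b , v≤b , fb<v , b-last | c , x₀≤c , fc≡v , c-last =
        avoids (a , b , c , a<b , <-≤-trans b<x₀ x₀≤c , σb<σc , σc<σa)
        where
        σb≡fb : phi f b ≡ f b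
        σb≡fb = phi-fixed-value b λ j b<j fj≡fb →
          b-last j b<j (subst (λ z → toℕ z < toℕ v) (sym fj≡fb) fb<v)

        σc≡v : phi f c ≡ v
        σc≡v = trans (phi-fixed-value c λ j c<j fj≡fc → c-last j c<j (trans fj≡fc fc≡v)) fc≡v

        a<b : toℕ a < toℕ b
        a<b = subst (_≤ toℕ b) (sym 1+a≡v) v≤b

        b<x₀ : toℕ b < toℕ x₀
        b<x₀ = ≰⇒> λ x₀≤b → ≤⇒≯ (subst (λ z → toℕ z ≤ toℕ (f b)) fx₀≡v (mon x₀ b x₀≤b)) fb<v

        σb<σc : toℕ (phi f b) < toℕ (phi f c)
        σb<σc = subst₂ (λ y z → toℕ y < toℕ z) (sym σb≡fb) (sym σc≡v) fb<v

        σc<σa : toℕ (phi f c) < toℕ (phi f a)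
        σc<σa = subst (λ z → toℕ z < toℕ (phi f a)) (sym σc≡v) v<σa

      avoids312⇒fixes-image : Avoids312 (phi f) → ∀ v → InIm f v → f v ≡ v
      avoids312⇒fixes-image avoids = All.wfRec <-wellFounded 0ℓ (λ v → InIm f v → f v ≡ v) fixes
        where
        fixes : ∀ v → (∀ {w} → toℕ w < toℕ v → InIm f w → f w ≡ w) → InIm f v → f v ≡ v
        fixes v below (x₀ , fx₀≡v) with f v ≟ v
        ... | yes fv≡v = fv≡v
        ... | no fv≢v =
          contradiction avoids (unfixed-image⇒¬avoids312 fv<v (below fv<v (v , refl)) fx₀≡v v<x₀)
          where
          fv<v : toℕ (f v) < toℕ v
          fv<v = ≤∧≢⇒<ᶠ (sub v) fv≢v

          v<x₀ : toℕ v < toℕ x₀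
          v<x₀ = ≤∧≢⇒<ᶠ (subst (λ z → toℕ z ≤ toℕ x₀) fx₀≡v (sub x₀))
                        (λ v≡x₀ → fv≢v (trans (cong f v≡x₀) fx₀≡v))

open Sweep using (Y⇒avoids312; avoids312⇒fixes-image)

proposition5p7 : (n : ℕ) (f : Fin n → Fin n) → InFnInc f →
    (InY f → Avoids312 (phi f)) × (Avoids312 (phi f) → InY f)
proposition5p7 n f (sub , mon) =
  (λ (_ , fixes-image) → Y⇒avoids312 f sub mon fixes-image) ,
  (λ avoids → (sub , mon) , avoids312⇒fixes-image f sub mon avoids)
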